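{- Let $T\ge 1$, $d\ge1$, and let $C_1,\dots,C_T\subset\{0,1\}^d$ be nonempty constituent codes of a $T$-user uniquely decodable code with sum rate $R$. Suppose that there exists $j$ such that $\overline{\mathrm{wt}}(C_j)\ne d/2$. Then there exist a positive integer $n$ and constituent codes $C_1^*,\dots,C_T^*\subset\{0,1\}^{dn}$ such that $C_1^*,\dots,C_T^*$ is a $T$-user uniquely decodable code with sum rate strictly larger than $R$.
   Context: A $T$-user code in dimension $m$ consists of constituent codes $C_1,\dots,C_T\subset\{0,1\}^m$. It is uniquely decodable (UD) if for every $x\in\mathbb{Z}^m$ there is at most one tuple $(u_1,\dots,u_T)$ with $u_i\in C_i$ and $u_1+\dots+u_T=x$, where addition is in $\mathbb{Z}^m$. Its sum rate is $\frac1m\log_2\prod_{i=1}^T|C_i|$. For a binary vector $x$, $\mathrm{wt}(x)$ is its Hamming weight, and for a nonempty code $C$, $\overline{\mathrm{wt}}(C)$ is the average Hamming weight of the vectors in $C$. -}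

module Defs where

open import Data.Nat using (ℕ; zero; suc; _+_; _*_)
open import Data.Bool using (Bool; true; false; if_then_else_)
open import Data.Fin using (Fin; zero; suc)
open import Data.Vec using (Vec; map; replicate; zipWith; count)
open import Data.List using (List; length)
open import Data.Nat.ListAction using (sum)
import Data.List as L
open import Data.List.Membership.Propositional using (_∈_)
open import Relation.Binary.PropositionalEquality using (_≡_)
open import Relation.Nullary using (does)
open import Data.Bool.Properties using (T?)

Word : ℕ → Set
Word m = Vec Bool m

-- A code C ⊆ {0,1}^m is represented as a list of words; distinctness
-- of its elements is imposed separately (Unique), so |C| = length C.
Code : ℕ → Set
Code m = List (Word m)

-- Embedding {0,1}^m into ℤ^m (entries are nonnegative, so ℕ^m suffices).
toℕs : ∀ {m} → Word m → Vec ℕ m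
toℕs = map (λ b → if b then 1 else 0)

sumWords : ∀ {m} (T : ℕ) → (Fin T → Word m) → Vec ℕ m
sumWords {m} zero    u = replicate m 0
sumWords     (suc T) u = zipWith _+_ (toℕs (u zero)) (sumWords T (λ i → u (suc i)))

UD : ∀ {m} (T : ℕ) → (Fin T → Code m) → Set
UD {m} T C =
  (u v : Fin T → Word m) →
  (∀ i → u i ∈ C i) → (∀ i → v i ∈ C i) →
  sumWords T u ≡ sumWords T v → ∀ i → u i ≡ v i

prodSize : ∀ {m} (T : ℕ) → (Fin T → Code m) → ℕ
prodSize zero    C = 1
prodSize (suc T) C = length (C zero) * prodSize T (λ i → C (suc i))

wt : ∀ {m} → Word m → ℕ
wt = count (λ b → T? b)

-- Total weight Σ_{c∈C} wt(c); average weight = totalWt C / |C|.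
totalWt : ∀ {m} → Code m → ℕ
totalWt C = sum (L.map wt C)

{-# OPTIONS --safe #-}
module Submission where

-- Pass to the n-fold power of the code, which is again uniquely decodable, and let each user
-- keep only its typical words, those whose weight, scaled by |C_i|, is within n / r of its
-- mean over the power code. The second moment of the weight grows linearly in n, so by Chebyshev's
-- inequality each user keeps a fraction (2T + 1) / (2T + 2) of its words once n is large.
-- The typical weights of user j lie near n times its mean weight, which differs from d / 2,
-- so those of the complements lie far away from them; with r = 2 + 2 T |C_j| a tuple using a
-- complement for user j therefore never has the total weight of a tuple of typical words.
-- Hence user j may also use the complements of its typical words, which doubles the number
-- of tuples, and ((2T + 2) / (2T + 1)) ^ T < 2 gives a larger product of code sizes.

open import Defs
open import Data.Nat using (ℕ; zero; suc; _+_; _*_; _^_; _≤_; _<_; z≤n; s≤s; NonZero; >-nonZero; ≢-nonZero)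
import Data.Nat.Properties as ℕ
open import Data.Nat.Tactic.RingSolver using (solve-∀)
open import Data.Bool using (Bool; true; false; not; if_then_else_)
open import Data.Bool.Properties using (not-injective)
open import Data.Fin using (Fin; zero; suc; _≟_)
open import Data.Vec as Vec using (Vec; []; _∷_; _++_; lookup; replicate; zipWith; map)
import Data.Vec.Properties as Vecₚ
import Data.Vec.Functional as Tuple
import Data.Vec.Functional.Properties as Tupleₚ
open import Data.List using (List; []; _∷_; length; cartesianProductWith)
import Data.Nat.ListAction as ListAction
import Data.List as List
import Data.List.Properties as Listₚ
import Data.List.Relation.Unary.All as All
import Data.List.Relation.Unary.AllPairs as AllPairs
open import Data.List.Membership.Propositional using (_∈_)
open import Data.List.Membership.Propositional.Properties
  using (∈-cartesianProductWith⁻; ∈-map⁻; ∈-++⁻; ∈-filter⁻)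
open import Data.List.Relation.Unary.Unique.Propositional using (Unique)
import Data.List.Relation.Unary.Unique.Propositional.Properties as Unique
open import Data.Product using (Σ; ∃; _×_; _,_; proj₁; proj₂)
open import Data.Sum using (_⊎_; inj₁; inj₂)
open import Data.Empty using (⊥; ⊥-elim)
open import Function using (_∘_; const)
open import Data.Integer as ℤ using (ℤ; +_; ∣_∣)
import Data.Integer.Properties as ℤ
import Data.Integer.Tactic.RingSolver as ℤSolver
open import Relation.Nullary using (yes; no; ¬?)
open import Relation.Unary using (Decidable)
open import Relation.Binary.PropositionalEquality
open import Algebra.Properties.Monoid.Sum ℕ.+-0-monoid using (sum; sum-cong-≗)
open import Algebra.Properties.CommutativeSemigroup ℕ.*-commutativeSemigroup using (x∙yz≈y∙xz)

bit : Bool → ℕ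
bit b = if b then 1 else 0

complement : ∀ {m} → Word m → Word m
complement = map not

wt-++ : ∀ {m k} (a : Word m) (b : Word k) → wt (a ++ b) ≡ wt a + wt b
wt-++ []          b = refl
wt-++ (true ∷ a)  b = cong suc (wt-++ a b)
wt-++ (false ∷ a) b = wt-++ a b

wt-complement : ∀ {m} (b : Word m) → wt (complement b) + wt b ≡ m
wt-complement []          = refl
wt-complement (true ∷ b)  = trans (ℕ.+-suc _ _) (cong suc (wt-complement b))
wt-complement (false ∷ b) = cong suc (wt-complement b)

bit-complement : ∀ {m} (b : Word m) k → bit (lookup (complement b) k) + bit (lookup b k) ≡ 1
bit-complement b k rewrite Vecₚ.lookup-map k not b with lookup b k
... | true  = refl
... | false = refl

complement-injective : ∀ {m} {a b : Word m} → complement a ≡ complement b → a ≡ b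
complement-injective {a = []}    {[]}    _ = refl
complement-injective {a = x ∷ a} {y ∷ b} e =
  cong₂ _∷_ (not-injective (Vecₚ.∷-injectiveˡ e)) (complement-injective (Vecₚ.∷-injectiveʳ e))

sum-updateAt : ∀ {T} (f : Fin T → ℕ) j x →
  sum (Tuple.updateAt f j (const x)) + f j ≡ sum f + x
sum-updateAt {suc T} f zero    x = swap x (sum (f ∘ suc)) (f zero)
  where
  swap : ∀ a b c → a + b + c ≡ c + b + a
  swap = solve-∀
sum-updateAt {suc T} f (suc j) x = begin
  f zero + sum (Tuple.updateAt (f ∘ suc) j (const x)) + f (suc j)
    ≡⟨ ℕ.+-assoc (f zero) _ _ ⟩
  f zero + (sum (Tuple.updateAt (f ∘ suc) j (const x)) + f (suc j))
    ≡⟨ cong (_+_ (f zero)) (sum-updateAt (f ∘ suc) j x) ⟩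
  f zero + (sum (f ∘ suc) + x)
    ≡⟨ ℕ.+-assoc (f zero) _ x ⟨
  f zero + sum (f ∘ suc) + x ∎
  where open ≡-Reasoning

≤-sum : ∀ {T} (f : Fin T → ℕ) i → f i ≤ sum f
≤-sum f zero    = ℕ.m≤m+n (f zero) _
≤-sum f (suc i) = ℕ.≤-trans (≤-sum (f ∘ suc) i) (ℕ.m≤n+m _ (f zero))

*-∣sum-sum∣-≤ : ∀ {T} (f g : Fin T → ℕ) r B → (∀ i → r * ∣ + f i ℤ.- + g i ∣ ≤ B) →
  r * ∣ + sum f ℤ.- + sum g ∣ ≤ T * B
*-∣sum-sum∣-≤ {zero}  f g r B bound = ℕ.≤-reflexive (ℕ.*-zeroʳ r)
*-∣sum-sum∣-≤ {suc T} f g r B bound = begin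
  r * ∣ + (f zero + sum (f ∘ suc)) ℤ.- + (g zero + sum (g ∘ suc)) ∣
    ≡⟨ cong (λ z → r * ∣ z ∣) (regroup (f zero) (sum (f ∘ suc)) (g zero) (sum (g ∘ suc))) ⟩
  r * ∣ (+ f zero ℤ.- + g zero) ℤ.+ (+ sum (f ∘ suc) ℤ.- + sum (g ∘ suc)) ∣
    ≤⟨ ℕ.*-monoʳ-≤ r (ℤ.∣i+j∣≤∣i∣+∣j∣ (+ f zero ℤ.- + g zero) _) ⟩
  r * (∣ + f zero ℤ.- + g zero ∣ + ∣ + sum (f ∘ suc) ℤ.- + sum (g ∘ suc) ∣)
    ≡⟨ ℕ.*-distribˡ-+ r _ _ ⟩
  r * ∣ + f zero ℤ.- + g zero ∣ + r * ∣ + sum (f ∘ suc) ℤ.- + sum (g ∘ suc) ∣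
    ≤⟨ ℕ.+-mono-≤ (bound zero) (*-∣sum-sum∣-≤ (f ∘ suc) (g ∘ suc) r B (bound ∘ suc)) ⟩
  B + T * B ∎
  where
  open ℕ.≤-Reasoning
  regroup : ∀ a b c d → + (a + b) ℤ.- + (c + d) ≡ (+ a ℤ.- + c) ℤ.+ (+ b ℤ.- + d)
  regroup a b c d = trans (cong₂ ℤ._-_ (ℤ.pos-+ a b) (ℤ.pos-+ c d)) (ℤ-regroup (+ a) (+ b) (+ c) (+ d))
    where
    ℤ-regroup : ∀ a b c d → a ℤ.+ b ℤ.- (c ℤ.+ d) ≡ (a ℤ.- c) ℤ.+ (b ℤ.- d)
    ℤ-regroup = ℤSolver.solve-∀

lookup-sumWords : ∀ {m} T (u : Fin T → Word m) k →
  lookup (sumWords T u) k ≡ sum (λ i → bit (lookup (u i) k))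
lookup-sumWords zero    u k = Vecₚ.lookup-replicate k 0
lookup-sumWords (suc T) u k = begin
  lookup (zipWith _+_ (toℕs (u zero)) (sumWords T (u ∘ suc))) k
    ≡⟨ Vecₚ.lookup-zipWith _+_ k (toℕs (u zero)) _ ⟩
  lookup (toℕs (u zero)) k + lookup (sumWords T (u ∘ suc)) k
    ≡⟨ cong₂ _+_ (Vecₚ.lookup-map k bit (u zero)) (lookup-sumWords T (u ∘ suc) k) ⟩
  bit (lookup (u zero) k) + sum (λ i → bit (lookup (u (suc i)) k)) ∎
  where open ≡-Reasoning

sumWords-cong : ∀ {m} T {u v : Fin T → Word m} → (∀ i → u i ≡ v i) → sumWords T u ≡ sumWords T v
sumWords-cong zero    eq = refl
sumWords-cong (suc T) eq = cong₂ (zipWith _+_) (cong toℕs (eq zero)) (sumWords-cong T (eq ∘ suc))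

sumWords-++ : ∀ {m k} T (a : Fin T → Word m) (b : Fin T → Word k) →
  sumWords T (λ i → a i ++ b i) ≡ sumWords T a ++ sumWords T b
sumWords-++ {m} {k} zero a b = replicate-++ m
  where
  replicate-++ : ∀ m → replicate (m + k) 0 ≡ replicate m 0 ++ replicate k 0
  replicate-++ zero    = refl
  replicate-++ (suc m) = cong (0 ∷_) (replicate-++ m)
sumWords-++ (suc T) a b = begin
  zipWith _+_ (toℕs (a zero ++ b zero)) (sumWords T (λ i → a (suc i) ++ b (suc i)))
    ≡⟨ cong₂ (zipWith _+_) (Vecₚ.map-++ bit (a zero) (b zero)) (sumWords-++ T (a ∘ suc) (b ∘ suc)) ⟩
  zipWith _+_ (toℕs (a zero) ++ toℕs (b zero)) (sumWords T (a ∘ suc) ++ sumWords T (b ∘ suc))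
    ≡⟨ Vecₚ.zipWith-++ _+_ (toℕs (a zero)) (toℕs (b zero)) _ _ ⟩
  sumWords (suc T) a ++ sumWords (suc T) b ∎
  where open ≡-Reasoning

Vec-sum-sumWords : ∀ {m} T (u : Fin T → Word m) → Vec.sum (sumWords T u) ≡ sum (wt ∘ u)
Vec-sum-sumWords {m} zero u = sum-replicate-0 m
  where
  sum-replicate-0 : ∀ m → Vec.sum (replicate m 0) ≡ 0
  sum-replicate-0 zero    = refl
  sum-replicate-0 (suc m) = sum-replicate-0 m
Vec-sum-sumWords (suc T) u = begin
  Vec.sum (zipWith _+_ (toℕs (u zero)) (sumWords T (u ∘ suc)))
    ≡⟨ sum-zipWith-+ (toℕs (u zero)) _ ⟩
  Vec.sum (toℕs (u zero)) + Vec.sum (sumWords T (u ∘ suc))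
    ≡⟨ cong₂ _+_ (sum-toℕs (u zero)) (Vec-sum-sumWords T (u ∘ suc)) ⟩
  wt (u zero) + sum (wt ∘ u ∘ suc) ∎
  where
  open ≡-Reasoning
  sum-zipWith-+ : ∀ {m} (a b : Vec ℕ m) → Vec.sum (zipWith _+_ a b) ≡ Vec.sum a + Vec.sum b
  sum-zipWith-+ []      []      = refl
  sum-zipWith-+ (x ∷ a) (y ∷ b) =
    trans (cong (_+_ (x + y)) (sum-zipWith-+ a b)) (interchange x y (Vec.sum a) (Vec.sum b))
    where
    interchange : ∀ x y p q → x + y + (p + q) ≡ x + p + (y + q)
    interchange = solve-∀
  sum-toℕs : ∀ {m} (w : Word m) → Vec.sum (toℕs w) ≡ wt w
  sum-toℕs []          = refl
  sum-toℕs (true ∷ w)  = cong suc (sum-toℕs w)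
  sum-toℕs (false ∷ w) = sum-toℕs w

lookup-injective : ∀ {A : Set} {m} {x y : Vec A m} → (∀ k → lookup x k ≡ lookup y k) → x ≡ y
lookup-injective {x = x} {y} eq =
  trans (sym (Vecₚ.tabulate∘lookup x)) (trans (Vecₚ.tabulate-cong eq) (Vecₚ.tabulate∘lookup y))

infixr 6 _⊗_

_⊗_ : ∀ {m k} → Code m → Code k → Code (m + k)
_⊗_ = cartesianProductWith _++_

power : ∀ {d} → Code d → (n : ℕ) → Code (n * d)
power C zero    = [] ∷ []
power C (suc n) = C ⊗ power C n

length-⊗ : ∀ {m k} (C : Code m) (D : Code k) → length (C ⊗ D) ≡ length C * length D
length-⊗ []      D = refl
length-⊗ (c ∷ C) D = begin
  length (List.map (c ++_) D List.++ C ⊗ D)   ≡⟨ Listₚ.length-++ (List.map (c ++_) D) ⟩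
  length (List.map (c ++_) D) + length (C ⊗ D) ≡⟨ cong₂ _+_ (Listₚ.length-map (c ++_) D) (length-⊗ C D) ⟩
  length D + length C * length D               ∎
  where open ≡-Reasoning

++-injective : ∀ {A : Set} {m k} {a b : Vec A m} {x y : Vec A k} → a ++ x ≡ b ++ y → a ≡ b × x ≡ y
++-injective {a = a} {b} = Vecₚ.++-injective a b

Unique-⊗ : ∀ {m k} {C : Code m} {D : Code k} → Unique C → Unique D → Unique (C ⊗ D)
Unique-⊗ = Unique.cartesianProductWith⁺ _++_ ++-injective

∈-⊗⁻ : ∀ {m k T} (F : Fin T → Code m) (G : Fin T → Code k) {w : Fin T → Word (m + k)} →
  (∀ i → w i ∈ F i ⊗ G i) →
  Σ (Fin T → Word m) λ a → Σ (Fin T → Word k) λ b →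
    (∀ i → a i ∈ F i) × (∀ i → b i ∈ G i) × (∀ i → w i ≡ a i ++ b i)
∈-⊗⁻ F G w∈ =
    (λ i → proj₁ (split i)) , (λ i → proj₁ (proj₂ (split i)))
  , (λ i → proj₁ (proj₂ (proj₂ (split i)))) , (λ i → proj₁ (proj₂ (proj₂ (proj₂ (split i)))))
  , (λ i → proj₂ (proj₂ (proj₂ (proj₂ (split i)))))
  where split = λ i → ∈-cartesianProductWith⁻ _++_ (F i) (G i) (w∈ i)

UD-⊗ : ∀ {m k} T {F : Fin T → Code m} {G : Fin T → Code k} → UD T F → UD T G → UD T (λ i → F i ⊗ G i)
UD-⊗ T {F} {G} udF udG u v u∈ v∈ sums i
  with a , b , a∈ , b∈ , u≡ab ← ∈-⊗⁻ F G u∈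
     | a′ , b′ , a′∈ , b′∈ , v≡ab′ ← ∈-⊗⁻ F G v∈ =
  trans (u≡ab i) (trans (cong₂ _++_ (udF a a′ a∈ a′∈ (proj₁ halves) i) (udG b b′ b∈ b′∈ (proj₂ halves) i))
                        (sym (v≡ab′ i)))
  where
  halves : sumWords T a ≡ sumWords T a′ × sumWords T b ≡ sumWords T b′
  halves = ++-injective (begin
    sumWords T a ++ sumWords T b            ≡⟨ sumWords-++ T a b ⟨
    sumWords T (λ i → a i ++ b i)           ≡⟨ sumWords-cong T u≡ab ⟨
    sumWords T u                            ≡⟨ sums ⟩
    sumWords T v                            ≡⟨ sumWords-cong T v≡ab′ ⟩
    sumWords T (λ i → a′ i ++ b′ i)         ≡⟨ sumWords-++ T a′ b′ ⟩
    sumWords T a′ ++ sumWords T b′          ∎)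
    where open ≡-Reasoning

UD-power : ∀ {d} T {C : Fin T → Code d} → UD T C → ∀ n → UD T (λ i → power (C i) n)
UD-power T udC zero    u v _ _ _ i = empty-unique (u i) (v i)
  where
  empty-unique : (x y : Word 0) → x ≡ y
  empty-unique [] [] = refl
UD-power T udC (suc n) = UD-⊗ T udC (UD-power T udC n)

Unique-power : ∀ {d} {C : Code d} → Unique C → ∀ n → Unique (power C n)
Unique-power uC zero    = All.[] AllPairs.∷ AllPairs.[]
Unique-power uC (suc n) = Unique-⊗ uC (Unique-power uC n)

length-power : ∀ {d} (C : Code d) n → length (power C n) ≡ length C ^ n
length-power C zero    = refl
length-power C (suc n) = trans (length-⊗ C (power C n)) (cong (length C *_) (length-power C n))

^-distribʳ-* : ∀ a b n → (a * b) ^ n ≡ a ^ n * b ^ n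
^-distribʳ-* a b zero    = refl
^-distribʳ-* a b (suc n) = trans (cong (a * b *_) (^-distribʳ-* a b n)) (ℕ.[m*n]*[o*p]≡[m*o]*[n*p] a b (a ^ n) (b ^ n))

prodSize-power : ∀ {d} T (C : Fin T → Code d) n → prodSize T (λ i → power (C i) n) ≡ prodSize T C ^ n
prodSize-power zero    C n = sym (ℕ.^-zeroˡ n)
prodSize-power (suc T) C n = begin
  length (power (C zero) n) * prodSize T (λ i → power (C (suc i)) n)
    ≡⟨ cong₂ _*_ (length-power (C zero) n) (prodSize-power T (C ∘ suc) n) ⟩
  length (C zero) ^ n * prodSize T (C ∘ suc) ^ n
    ≡⟨ ^-distribʳ-* (length (C zero)) _ n ⟨
  prodSize (suc T) C ^ n ∎
  where open ≡-Reasoning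

-- Complementing and augmenting one user

fill-in : ∀ {T} {A : Fin T → Set} j → (∀ i → i ≢ j → A i) → A j → ∀ i → A i
fill-in j others at-j i with i ≟ j
... | yes refl = at-j
... | no  i≢j  = others i i≢j

module _ {T : ℕ} {A : Set} where

  ∈-updateAt⁻ : ∀ {F : Fin T → List A} {j g} {u : Fin T → A} → (∀ i → u i ∈ Tuple.updateAt F j g i) →
    (∀ i → i ≢ j → u i ∈ F i) × u j ∈ g (F j)
  ∈-updateAt⁻ {F} {j} {u = u} u∈ =
      (λ i i≢j → subst (u i ∈_) (Tupleₚ.updateAt-minimal i j F i≢j) (u∈ i))
    , subst (u j ∈_) (Tupleₚ.updateAt-updates j F) (u∈ j)

  ∈-updateAt⁺ : ∀ {F : Fin T → List A} {j g} {u : Fin T → A} →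
    (∀ i → i ≢ j → u i ∈ F i) → u j ∈ g (F j) → ∀ i → u i ∈ Tuple.updateAt F j g i
  ∈-updateAt⁺ {F} {j} {u = u} others at-j = fill-in j
    (λ i i≢j → subst (u i ∈_) (sym (Tupleₚ.updateAt-minimal i j F i≢j)) (others i i≢j))
    (subst (u j ∈_) (sym (Tupleₚ.updateAt-updates j F)) at-j)

  updateAt-∈ : ∀ {F : Fin T → List A} {j x} {u : Fin T → A} →
    (∀ i → i ≢ j → u i ∈ F i) → x ∈ F j → ∀ i → Tuple.updateAt u j (const x) i ∈ F i
  updateAt-∈ {F} {j} {u = u} others x∈ = fill-in j
    (λ i i≢j → subst (_∈ F i) (sym (Tupleₚ.updateAt-minimal i j u i≢j)) (others i i≢j))
    (subst (_∈ F j) (sym (Tupleₚ.updateAt-updates j u)) x∈)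

lookup-sumWords-updateAt : ∀ {m} T (u : Fin T → Word m) j x k →
  lookup (sumWords T (Tuple.updateAt u j (const x))) k + bit (lookup (u j) k)
    ≡ lookup (sumWords T u) k + bit (lookup x k)
lookup-sumWords-updateAt T u j x k = begin
  lookup (sumWords T (Tuple.updateAt u j (const x))) k + column j
    ≡⟨ cong (_+ column j) (lookup-sumWords T _ k) ⟩
  sum (λ i → bit (lookup (Tuple.updateAt u j (const x) i) k)) + column j
    ≡⟨ cong (_+ column j) (sum-cong-≗ (Tupleₚ.map-updateAt-local {f = λ w → bit (lookup w k)} {g = const x} u j refl)) ⟩
  sum (Tuple.updateAt column j (const (bit (lookup x k)))) + column j
    ≡⟨ sum-updateAt column j _ ⟩
  sum column + bit (lookup x k)
    ≡⟨ cong (_+ bit (lookup x k)) (lookup-sumWords T u k) ⟨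
  lookup (sumWords T u) k + bit (lookup x k) ∎
  where
  open ≡-Reasoning
  column : Fin T → ℕ
  column i = bit (lookup (u i) k)

complementAt : ∀ {m T} → (Fin T → Code m) → Fin T → Fin T → Code m
complementAt F j = Tuple.updateAt F j (List.map complement)

augmentAt : ∀ {m T} → (Fin T → Code m) → Fin T → Fin T → Code m
augmentAt F j = Tuple.updateAt F j (λ D → D List.++ List.map complement D)

-- Exchanging the complemented words a̅ and b̅ for b and a keeps the column sums equal,
-- since bit (not x) + bit x = 1 in every column.
complementAt-UD : ∀ {m} T {F : Fin T → Code m} j → UD T F → UD T (complementAt F j)
complementAt-UD {m} T {F} j udF u v u∈ v∈ sums
  with u-others , uj∈ ← ∈-updateAt⁻ u∈ | v-others , vj∈ ← ∈-updateAt⁻ v∈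
  with a , a∈ , uj≡ ← ∈-map⁻ complement uj∈ | b , b∈ , vj≡ ← ∈-map⁻ complement vj∈ = same-at
  where
  u′ = Tuple.updateAt u j (const b)
  v′ = Tuple.updateAt v j (const a)

  swapped : ∀ (w : Fin T → Word m) c x k → w j ≡ complement c →
    lookup (sumWords T (Tuple.updateAt w j (const x))) k + 1
      ≡ lookup (sumWords T w) k + (bit (lookup x k) + bit (lookup c k))
  swapped w c x k wj≡ = begin
    S′ + 1
      ≡⟨ cong (_+_ S′) (bit-complement c k) ⟨
    S′ + (bit (lookup (complement c) k) + bit (lookup c k))
      ≡⟨ ℕ.+-assoc S′ _ _ ⟨
    S′ + bit (lookup (complement c) k) + bit (lookup c k)
      ≡⟨ cong (λ z → S′ + bit (lookup z k) + bit (lookup c k)) wj≡ ⟨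
    S′ + bit (lookup (w j) k) + bit (lookup c k)
      ≡⟨ cong (_+ bit (lookup c k)) (lookup-sumWords-updateAt T w j x k) ⟩
    lookup (sumWords T w) k + bit (lookup x k) + bit (lookup c k)
      ≡⟨ ℕ.+-assoc (lookup (sumWords T w) k) _ _ ⟩
    lookup (sumWords T w) k + (bit (lookup x k) + bit (lookup c k)) ∎
    where
    open ≡-Reasoning
    S′ = lookup (sumWords T (Tuple.updateAt w j (const x))) k

  sums′ : sumWords T u′ ≡ sumWords T v′
  sums′ = lookup-injective λ k → ℕ.+-cancelʳ-≡ 1 _ _ (begin
    lookup (sumWords T u′) k + 1
      ≡⟨ swapped u a b k uj≡ ⟩
    lookup (sumWords T u) k + (bit (lookup b k) + bit (lookup a k))
      ≡⟨ cong₂ _+_ (cong (λ s → lookup s k) sums) (ℕ.+-comm (bit (lookup b k)) _) ⟩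
    lookup (sumWords T v) k + (bit (lookup a k) + bit (lookup b k))
      ≡⟨ swapped v b a k vj≡ ⟨
    lookup (sumWords T v′) k + 1 ∎)
    where open ≡-Reasoning

  same : ∀ i → u′ i ≡ v′ i
  same = udF u′ v′ (updateAt-∈ u-others b∈) (updateAt-∈ v-others a∈) sums′

  same-at : ∀ i → u i ≡ v i
  same-at = fill-in j
    (λ i i≢j → trans (sym (Tupleₚ.updateAt-minimal i j u i≢j)) (trans (same i) (Tupleₚ.updateAt-minimal i j v i≢j)))
    (trans uj≡ (trans (cong complement (sym b≡a)) (sym vj≡)))
    where
    b≡a : b ≡ a
    b≡a = trans (sym (Tupleₚ.updateAt-updates j u)) (trans (same j) (Tupleₚ.updateAt-updates j v))

∈-augmentAt⁻ : ∀ {m T} {F : Fin T → Code m} {j} {u : Fin T → Word m} → (∀ i → u i ∈ augmentAt F j i) →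
  (∀ i → u i ∈ F i) ⊎ (∀ i → u i ∈ complementAt F j i)
∈-augmentAt⁻ {F = F} {j} u∈ with others , uj∈ ← ∈-updateAt⁻ u∈ with ∈-++⁻ (F j) uj∈
... | inj₁ uj∈F = inj₁ (fill-in j others uj∈F)
... | inj₂ uj∈F̅ = inj₂ (∈-updateAt⁺ others uj∈F̅)

augmentAt-UD : ∀ {m} T {F : Fin T → Code m} j → UD T F →
  (∀ u v → (∀ i → u i ∈ F i) → (∀ i → v i ∈ complementAt F j i) → sumWords T u ≢ sumWords T v) →
  UD T (augmentAt F j)
augmentAt-UD T j udF disjoint u v u∈ v∈ sums with ∈-augmentAt⁻ u∈ | ∈-augmentAt⁻ v∈
... | inj₁ u∈F | inj₁ v∈F = udF u v u∈F v∈F sums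
... | inj₁ u∈F | inj₂ v∈F̅ = ⊥-elim (disjoint u v u∈F v∈F̅ sums)
... | inj₂ u∈F̅ | inj₁ v∈F = ⊥-elim (disjoint v u v∈F u∈F̅ (sym sums))
... | inj₂ u∈F̅ | inj₂ v∈F̅ = complementAt-UD T j udF u v u∈F̅ v∈F̅ sums

updateAt-preserves : ∀ {T} {A : Set} {P : A → Set} {F : Fin T → A} {j g} →
  (∀ i → P (F i)) → P (g (F j)) → ∀ i → P (Tuple.updateAt F j g i)
updateAt-preserves {P = P} {F} {j} PF Pg = fill-in j
  (λ i i≢j → subst P (sym (Tupleₚ.updateAt-minimal i j F i≢j)) (PF i))
  (subst P (sym (Tupleₚ.updateAt-updates j F)) Pg)

Unique-augmentAt : ∀ {m T} {F : Fin T → Code m} j → (∀ i → Unique (F i)) →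
  (∀ {a b} → a ∈ F j → b ∈ F j → a ≢ complement b) → ∀ i → Unique (augmentAt F j i)
Unique-augmentAt {F = F} j uF self-disjoint = updateAt-preserves {P = Unique} uF
  (Unique.++⁺ (uF j) (Unique.map⁺ complement-injective (uF j)) disjoint)
  where
  disjoint : ∀ {w} → w ∈ F j × w ∈ List.map complement (F j) → ⊥
  disjoint (w∈ , w∈F̅) with b , b∈ , w≡ ← ∈-map⁻ complement w∈F̅ = self-disjoint w∈ b∈ w≡

prodSize-updateAt : ∀ {m} T (F : Fin T → Code m) j g c → length (g (F j)) ≡ c * length (F j) →
  prodSize T (Tuple.updateAt F j g) ≡ c * prodSize T F
prodSize-updateAt (suc T) F zero    g c len = trans (cong (_* prodSize T (F ∘ suc)) len) (ℕ.*-assoc c _ _)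
prodSize-updateAt (suc T) F (suc j) g c len =
  trans (cong (length (F zero) *_) (prodSize-updateAt T (F ∘ suc) j g c len)) (x∙yz≈y∙xz (length (F zero)) c _)

prodSize-augmentAt : ∀ {m} T (F : Fin T → Code m) j → prodSize T (augmentAt F j) ≡ 2 * prodSize T F
prodSize-augmentAt T F j = prodSize-updateAt T F j _ 2 (begin
  length (F j List.++ List.map complement (F j))     ≡⟨ Listₚ.length-++ (F j) ⟩
  length (F j) + length (List.map complement (F j))  ≡⟨ cong (_+_ (length (F j))) (Listₚ.length-map complement (F j)) ⟩
  length (F j) + length (F j)                        ≡⟨ cong (_+_ (length (F j))) (ℕ.+-identityʳ (length (F j))) ⟨
  2 * length (F j)                                   ∎)
  where open ≡-Reasoning

-- Deviation of the weight from its mean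

sumℤ : ∀ {A : Set} → List A → (A → ℤ) → ℤ
sumℤ []      f = + 0
sumℤ (x ∷ L) f = f x ℤ.+ sumℤ L f

module _ {A : Set} where

  sumℤ-cong : ∀ (L : List A) {f g : A → ℤ} → (∀ x → f x ≡ g x) → sumℤ L f ≡ sumℤ L g
  sumℤ-cong []      eq = refl
  sumℤ-cong (x ∷ L) eq = cong₂ ℤ._+_ (eq x) (sumℤ-cong L eq)

  sumℤ-++ : ∀ (L K : List A) f → sumℤ (L List.++ K) f ≡ sumℤ L f ℤ.+ sumℤ K f
  sumℤ-++ []      K f = sym (ℤ.+-identityˡ _)
  sumℤ-++ (x ∷ L) K f = trans (cong (ℤ._+_ (f x)) (sumℤ-++ L K f)) (sym (ℤ.+-assoc (f x) _ _))

  sumℤ-map : ∀ {B : Set} (g : A → B) (L : List A) f → sumℤ (List.map g L) f ≡ sumℤ L (f ∘ g)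
  sumℤ-map g []      f = refl
  sumℤ-map g (x ∷ L) f = cong (ℤ._+_ (f (g x))) (sumℤ-map g L f)

  sumℤ-+ : ∀ (L : List A) f g → sumℤ L (λ x → f x ℤ.+ g x) ≡ sumℤ L f ℤ.+ sumℤ L g
  sumℤ-+ []      f g = refl
  sumℤ-+ (x ∷ L) f g =
    trans (cong (ℤ._+_ (f x ℤ.+ g x)) (sumℤ-+ L f g)) (interchange (f x) (g x) (sumℤ L f) (sumℤ L g))
    where
    interchange : ∀ a b c d → a ℤ.+ b ℤ.+ (c ℤ.+ d) ≡ a ℤ.+ c ℤ.+ (b ℤ.+ d)
    interchange = ℤSolver.solve-∀

  sumℤ-*ˡ : ∀ (L : List A) k f → sumℤ L (λ x → k ℤ.* f x) ≡ k ℤ.* sumℤ L f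
  sumℤ-*ˡ []      k f = sym (ℤ.*-zeroʳ k)
  sumℤ-*ˡ (x ∷ L) k f = trans (cong (ℤ._+_ (k ℤ.* f x)) (sumℤ-*ˡ L k f)) (sym (ℤ.*-distribˡ-+ k (f x) _))

  sumℤ-const : ∀ (L : List A) k → sumℤ L (const k) ≡ + length L ℤ.* k
  sumℤ-const []      k = sym (ℤ.*-zeroˡ k)
  sumℤ-const (x ∷ L) k = trans (cong (ℤ._+_ k) (sumℤ-const L k)) (sym (ℤ.suc-* (+ length L) k))

  sumℤ-pos : ∀ (L : List A) f → sumℤ L (λ x → + f x) ≡ + ListAction.sum (List.map f L)
  sumℤ-pos []      f = refl
  sumℤ-pos (x ∷ L) f = trans (cong (ℤ._+_ (+ f x)) (sumℤ-pos L f)) (sym (ℤ.pos-+ (f x) _))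

sumℤ-⊗ : ∀ {m k} (C : Code m) (D : Code k) f → sumℤ (C ⊗ D) f ≡ sumℤ C (λ c → sumℤ D (λ y → f (c ++ y)))
sumℤ-⊗ []      D f = refl
sumℤ-⊗ (c ∷ C) D f =
  trans (sumℤ-++ (List.map (c ++_) D) (C ⊗ D) f) (cong₂ ℤ._+_ (sumℤ-map (c ++_) D f) (sumℤ-⊗ C D f))

-- deviation n x is |C| (wt x − μ) for the mean weight μ = n τ / |C| of the power code,
-- scaled by |C| to stay integral.
module Deviation {d : ℕ} (C : Code d) where

  M τ : ℕ
  M = length C
  τ = totalWt C

  deviation₁ : Word d → ℤ
  deviation₁ c = + (M * wt c) ℤ.- + τ

  deviation : ∀ n → Word (n * d) → ℤ
  deviation n x = + (M * wt x) ℤ.- + (n * τ)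

  sum-deviation₁ : sumℤ C deviation₁ ≡ + 0
  sum-deviation₁ = begin
    sumℤ C deviation₁
      ≡⟨ sumℤ-+ C (λ c → + (M * wt c)) (const (ℤ.- + τ)) ⟩
    sumℤ C (λ c → + (M * wt c)) ℤ.+ sumℤ C (const (ℤ.- + τ))
      ≡⟨ cong₂ ℤ._+_ (sumℤ-cong C (λ c → ℤ.pos-* M (wt c))) (sumℤ-const C (ℤ.- + τ)) ⟩
    sumℤ C (λ c → + M ℤ.* + wt c) ℤ.+ + M ℤ.* (ℤ.- + τ)
      ≡⟨ cong (ℤ._+ + M ℤ.* (ℤ.- + τ)) (trans (sumℤ-*ˡ C (+ M) (λ c → + wt c)) (cong (+ M ℤ.*_) (sumℤ-pos C wt))) ⟩
    + M ℤ.* + τ ℤ.+ + M ℤ.* (ℤ.- + τ)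
      ≡⟨ cancel (+ M) (+ τ) ⟩
    + 0 ∎
    where
    open ≡-Reasoning
    cancel : ∀ a b → a ℤ.* b ℤ.+ a ℤ.* (ℤ.- b) ≡ + 0
    cancel = ℤSolver.solve-∀

  deviation-++ : ∀ n (c : Word d) (y : Word (n * d)) → deviation (suc n) (c ++ y) ≡ deviation₁ c ℤ.+ deviation n y
  deviation-++ n c y = begin
    + (M * wt (c ++ y)) ℤ.- + (τ + n * τ)
      ≡⟨ cong₂ (λ p q → + (M * p) ℤ.- q) (wt-++ c y) (ℤ.pos-+ τ (n * τ)) ⟩
    + (M * (wt c + wt y)) ℤ.- (+ τ ℤ.+ + (n * τ))
      ≡⟨ cong (ℤ._- (+ τ ℤ.+ + (n * τ)))
              (trans (cong +_ (ℕ.*-distribˡ-+ M (wt c) (wt y))) (ℤ.pos-+ (M * wt c) (M * wt y))) ⟩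
    + (M * wt c) ℤ.+ + (M * wt y) ℤ.- (+ τ ℤ.+ + (n * τ))
      ≡⟨ regroup (+ (M * wt c)) (+ (M * wt y)) (+ τ) (+ (n * τ)) ⟩
    deviation₁ c ℤ.+ deviation n y ∎
    where
    open ≡-Reasoning
    regroup : ∀ a b c d → a ℤ.+ b ℤ.- (c ℤ.+ d) ≡ (a ℤ.- c) ℤ.+ (b ℤ.- d)
    regroup = ℤSolver.solve-∀

  deviation-[] : (x : Word (0 * d)) → deviation 0 x ≡ + 0
  deviation-[] [] = cong (λ z → + z ℤ.- + 0) (ℕ.*-zeroʳ M)

  deviation-identity : ∀ n (a b : Word (n * d)) →
    + n ℤ.* (+ (2 * τ) ℤ.- + (d * M)) ≡ + M ℤ.* (+ wt a ℤ.+ + wt b ℤ.- + (n * d)) ℤ.- deviation n a ℤ.- deviation n b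
  deviation-identity n a b = begin
    + n ℤ.* (+ (2 * τ) ℤ.- + (d * M))
      ≡⟨ cong₂ (λ p q → + n ℤ.* (p ℤ.- q)) (ℤ.pos-* 2 τ) (ℤ.pos-* d M) ⟩
    + n ℤ.* (+ 2 ℤ.* + τ ℤ.- + d ℤ.* + M)
      ≡⟨ expand (+ n) (+ τ) (+ d) (+ M) (+ wt a) (+ wt b) ⟩
    + M ℤ.* (+ wt a ℤ.+ + wt b ℤ.- + n ℤ.* + d)
      ℤ.- (+ M ℤ.* + wt a ℤ.- + n ℤ.* + τ) ℤ.- (+ M ℤ.* + wt b ℤ.- + n ℤ.* + τ)
      ≡⟨ cong₂ (λ p q → + M ℤ.* (+ wt a ℤ.+ + wt b ℤ.- p) ℤ.- (+ M ℤ.* + wt a ℤ.- q) ℤ.- (+ M ℤ.* + wt b ℤ.- q))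
               (ℤ.pos-* n d) (ℤ.pos-* n τ) ⟨
    + M ℤ.* (+ wt a ℤ.+ + wt b ℤ.- + (n * d))
      ℤ.- (+ M ℤ.* + wt a ℤ.- + (n * τ)) ℤ.- (+ M ℤ.* + wt b ℤ.- + (n * τ))
      ≡⟨ cong₂ (λ p q → + M ℤ.* (+ wt a ℤ.+ + wt b ℤ.- + (n * d)) ℤ.- (p ℤ.- + (n * τ)) ℤ.- (q ℤ.- + (n * τ)))
               (ℤ.pos-* M (wt a)) (ℤ.pos-* M (wt b)) ⟨
    + M ℤ.* (+ wt a ℤ.+ + wt b ℤ.- + (n * d)) ℤ.- deviation n a ℤ.- deviation n b ∎
    where
    open ≡-Reasoning
    expand : ∀ n t d m a b →
      n ℤ.* (+ 2 ℤ.* t ℤ.- d ℤ.* m)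
        ≡ m ℤ.* (a ℤ.+ b ℤ.- n ℤ.* d) ℤ.- (m ℤ.* a ℤ.- n ℤ.* t) ℤ.- (m ℤ.* b ℤ.- n ℤ.* t)
    expand = ℤSolver.solve-∀

  sum-deviation : ∀ n → sumℤ (power C n) (deviation n) ≡ + 0
  sum-deviation zero    = cong (ℤ._+ + 0) (deviation-[] [])
  sum-deviation (suc n) = begin
    sumℤ (power C (suc n)) (deviation (suc n))
      ≡⟨ sumℤ-⊗ C (power C n) (deviation (suc n)) ⟩
    sumℤ C (λ c → sumℤ (power C n) (λ y → deviation (suc n) (c ++ y)))
      ≡⟨ sumℤ-cong C inner ⟩
    sumℤ C (λ c → + length (power C n) ℤ.* deviation₁ c)
      ≡⟨ sumℤ-*ˡ C (+ length (power C n)) deviation₁ ⟩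
    + length (power C n) ℤ.* sumℤ C deviation₁
      ≡⟨ cong (+ length (power C n) ℤ.*_) sum-deviation₁ ⟩
    + length (power C n) ℤ.* + 0
      ≡⟨ ℤ.*-zeroʳ (+ length (power C n)) ⟩
    + 0 ∎
    where
    open ≡-Reasoning
    inner : ∀ c → sumℤ (power C n) (λ y → deviation (suc n) (c ++ y)) ≡ + length (power C n) ℤ.* deviation₁ c
    inner c = begin
      sumℤ (power C n) (λ y → deviation (suc n) (c ++ y))
        ≡⟨ sumℤ-cong (power C n) (deviation-++ n c) ⟩
      sumℤ (power C n) (λ y → deviation₁ c ℤ.+ deviation n y)
        ≡⟨ sumℤ-+ (power C n) (const (deviation₁ c)) (deviation n) ⟩
      sumℤ (power C n) (const (deviation₁ c)) ℤ.+ sumℤ (power C n) (deviation n)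
        ≡⟨ cong₂ ℤ._+_ (sumℤ-const (power C n) (deviation₁ c)) (sum-deviation n) ⟩
      + length (power C n) ℤ.* deviation₁ c ℤ.+ + 0
        ≡⟨ ℤ.+-identityʳ _ ⟩
      + length (power C n) ℤ.* deviation₁ c ∎

  square₁ : Word d → ℤ
  square₁ c = deviation₁ c ℤ.* deviation₁ c

  square : ∀ n → Word (n * d) → ℤ
  square n x = deviation n x ℤ.* deviation n x

  -- The cross terms vanish because every block deviation sums to zero over C.
  sum-square : ∀ n → + M ℤ.* sumℤ (power C n) (square n) ≡ + n ℤ.* (+ (M ^ n) ℤ.* sumℤ C square₁)
  sum-square zero    = trans (cong (λ z → + M ℤ.* (z ℤ.* z ℤ.+ + 0)) (deviation-[] [])) (ℤ.*-zeroʳ (+ M))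
  sum-square (suc n) = begin
    + M ℤ.* sumℤ (power C (suc n)) (square (suc n))
      ≡⟨ cong (+ M ℤ.*_) (trans (sumℤ-⊗ C (power C n) (square (suc n))) (sumℤ-cong C inner)) ⟩
    + M ℤ.* sumℤ C (λ c → X ℤ.* square₁ c ℤ.+ Q)
      ≡⟨ cong (+ M ℤ.*_) (trans (sumℤ-+ C (λ c → X ℤ.* square₁ c) (const Q))
                                (cong₂ ℤ._+_ (sumℤ-*ˡ C X square₁) (sumℤ-const C Q))) ⟩
    + M ℤ.* (X ℤ.* V ℤ.+ + M ℤ.* Q)
      ≡⟨ cong (λ z → + M ℤ.* (X ℤ.* V ℤ.+ z)) (sum-square n) ⟩
    + M ℤ.* (X ℤ.* V ℤ.+ + n ℤ.* (X ℤ.* V))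
      ≡⟨ collect (+ M) X V (+ n) ⟩
    (+ 1 ℤ.+ + n) ℤ.* (+ M ℤ.* X ℤ.* V)
      ≡⟨ cong₂ (λ p q → p ℤ.* (q ℤ.* V)) (ℤ.pos-+ 1 n) (ℤ.pos-* M (M ^ n)) ⟨
    + suc n ℤ.* (+ (M ^ suc n) ℤ.* V) ∎
    where
    open ≡-Reasoning
    X = + (M ^ n)
    Q = sumℤ (power C n) (square n)
    V = sumℤ C square₁
    collect : ∀ m x v k → m ℤ.* (x ℤ.* v ℤ.+ k ℤ.* (x ℤ.* v)) ≡ (+ 1 ℤ.+ k) ℤ.* (m ℤ.* x ℤ.* v)
    collect = ℤSolver.solve-∀
    expand : ∀ a b → (a ℤ.+ b) ℤ.* (a ℤ.+ b) ≡ a ℤ.* a ℤ.+ ((+ 2 ℤ.* a) ℤ.* b ℤ.+ b ℤ.* b)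
    expand = ℤSolver.solve-∀
    inner : ∀ c → sumℤ (power C n) (λ y → square (suc n) (c ++ y)) ≡ X ℤ.* square₁ c ℤ.+ Q
    inner c = begin
      sumℤ (power C n) (λ y → square (suc n) (c ++ y))
        ≡⟨ sumℤ-cong (power C n) (λ y →
             trans (cong (λ z → z ℤ.* z) (deviation-++ n c y)) (expand (deviation₁ c) (deviation n y))) ⟩
      sumℤ (power C n) (λ y → square₁ c ℤ.+ (cross ℤ.* deviation n y ℤ.+ square n y))
        ≡⟨ sumℤ-+ (power C n) (const (square₁ c)) _ ⟩
      sumℤ (power C n) (const (square₁ c)) ℤ.+ sumℤ (power C n) (λ y → cross ℤ.* deviation n y ℤ.+ square n y)
        ≡⟨ cong₂ ℤ._+_ (sumℤ-const (power C n) (square₁ c))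
                       (sumℤ-+ (power C n) (λ y → cross ℤ.* deviation n y) (square n)) ⟩
      + length (power C n) ℤ.* square₁ c ℤ.+ (sumℤ (power C n) (λ y → cross ℤ.* deviation n y) ℤ.+ Q)
        ≡⟨ cong₂ (λ p q → p ℤ.* square₁ c ℤ.+ (q ℤ.+ Q)) (cong +_ (length-power C n))
                 (trans (sumℤ-*ˡ (power C n) cross (deviation n)) (trans (cong (cross ℤ.*_) (sum-deviation n)) (ℤ.*-zeroʳ cross))) ⟩
      X ℤ.* square₁ c ℤ.+ (+ 0 ℤ.+ Q)
        ≡⟨ cong (ℤ._+_ (X ℤ.* square₁ c)) (ℤ.+-identityˡ Q) ⟩
      X ℤ.* square₁ c ℤ.+ Q ∎
      where
      cross = + 2 ℤ.* deviation₁ c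

  sumSquares₁ : ℕ
  sumSquares₁ = ListAction.sum (List.map (λ c → ∣ deviation₁ c ∣ * ∣ deviation₁ c ∣) C)

  sum-∣deviation∣² : ∀ n →
    M * ListAction.sum (List.map (λ x → ∣ deviation n x ∣ * ∣ deviation n x ∣) (power C n)) ≡ n * (M ^ n * sumSquares₁)
  sum-∣deviation∣² n = ℤ.+-injective (begin
    + (M * ListAction.sum (List.map (λ x → ∣ deviation n x ∣ * ∣ deviation n x ∣) (power C n)))
      ≡⟨ ℤ.pos-* M _ ⟩
    + M ℤ.* + ListAction.sum (List.map (λ x → ∣ deviation n x ∣ * ∣ deviation n x ∣) (power C n))
      ≡⟨ cong (+ M ℤ.*_) (trans (sym (sumℤ-pos (power C n) _)) (sumℤ-cong (power C n) (∣i∣*∣i∣≡i*i ∘ deviation n))) ⟩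
    + M ℤ.* sumℤ (power C n) (square n)
      ≡⟨ sum-square n ⟩
    + n ℤ.* (+ (M ^ n) ℤ.* sumℤ C square₁)
      ≡⟨ cong (λ z → + n ℤ.* (+ (M ^ n) ℤ.* z))
              (trans (sumℤ-cong C (sym ∘ ∣i∣*∣i∣≡i*i ∘ deviation₁)) (sumℤ-pos C _)) ⟩
    + n ℤ.* (+ (M ^ n) ℤ.* + sumSquares₁)
      ≡⟨ trans (ℤ.pos-* n _) (cong (+ n ℤ.*_) (ℤ.pos-* (M ^ n) sumSquares₁)) ⟨
    + (n * (M ^ n * sumSquares₁)) ∎)
    where
    open ≡-Reasoning
    ∣i∣*∣i∣≡i*i : ∀ i → + (∣ i ∣ * ∣ i ∣) ≡ i ℤ.* i
    ∣i∣*∣i∣≡i*i (+ n)      = ℤ.pos-* n n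
    ∣i∣*∣i∣≡i*i ℤ.-[1+ n ] = refl

-- Typical words

length-filter-partition : ∀ {A : Set} {P : A → Set} (P? : Decidable P) L →
  length (List.filter P? L) + length (List.filter (¬? ∘ P?) L) ≡ length L
length-filter-partition P? []      = refl
length-filter-partition P? (x ∷ L) with P? x
... | yes _ = cong suc (length-filter-partition P? L)
... | no  _ = trans (ℕ.+-suc _ _) (cong suc (length-filter-partition P? L))

chebyshev : ∀ {W : Set} (D : W → ℤ) r n (typical? : Decidable (λ x → r * ∣ D x ∣ < n)) (L : List W) →
  length (List.filter (¬? ∘ typical?) L) * (n * n) ≤ r * r * ListAction.sum (List.map (λ x → ∣ D x ∣ * ∣ D x ∣) L)
chebyshev D r n typical? []      = z≤n
chebyshev D r n typical? (x ∷ L) with typical? x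
... | yes _ = ℕ.≤-trans (chebyshev D r n typical? L) (ℕ.*-monoʳ-≤ (r * r) (ℕ.m≤n+m _ _))
... | no  x-atypical = begin
  n * n + length (List.filter (¬? ∘ typical?) L) * (n * n)
    ≤⟨ ℕ.+-mono-≤ (ℕ.*-mono-≤ n≤rD n≤rD) (chebyshev D r n typical? L) ⟩
  r * ∣ D x ∣ * (r * ∣ D x ∣) + r * r * S
    ≡⟨ factor r (∣ D x ∣) S ⟩
  r * r * (∣ D x ∣ * ∣ D x ∣ + S) ∎
  where
  open ℕ.≤-Reasoning
  S = ListAction.sum (List.map (λ x → ∣ D x ∣ * ∣ D x ∣) L)
  n≤rD : n ≤ r * ∣ D x ∣
  n≤rD = ℕ.≮⇒≥ x-atypical
  factor : ∀ r a s → r * a * (r * a) + r * r * s ≡ r * r * (a * a + s)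
  factor = solve-∀

Typical : ∀ {d} (C : Code d) (r n : ℕ) → Word (n * d) → Set
Typical C r n x = r * ∣ Deviation.deviation C n x ∣ < n

typical? : ∀ {d} (C : Code d) r n → Decidable (Typical C r n)
typical? C r n x = r * ∣ Deviation.deviation C n x ∣ ℕ.<? n

typicalPart : ∀ {d} → Code d → (r n : ℕ) → Code (n * d)
typicalPart C r n = List.filter (typical? C r n) (power C n)

atypical-bound : ∀ {d} (C : Code d) r n K → 1 ≤ length C → .{{_ : NonZero n}} →
  K * (r * r) * Deviation.sumSquares₁ C ≤ n →
  K * length (List.filter (¬? ∘ typical? C r n) (power C n)) ≤ length C ^ n
atypical-bound C r n K 1≤M K*r²*V≤n =
  ℕ.≤-trans (ℕ.*-monoˡ-≤ B (ℕ.m≤m*n K M {{>-nonZero 1≤M}}))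
            (ℕ.*-cancelʳ-≤ (K * M * B) (M ^ n) (n * n) {{ℕ.m*n≢0 n n}} (begin
    K * M * B * (n * n)              ≡⟨ shuffle₁ K M B (n * n) ⟩
    K * M * (B * (n * n))            ≤⟨ ℕ.*-monoʳ-≤ (K * M) (chebyshev (deviation n) r n (typical? C r n) (power C n)) ⟩
    K * M * (r * r * S)              ≡⟨ shuffle₂ K M (r * r) S ⟩
    K * (r * r) * (M * S)            ≡⟨ cong (K * (r * r) *_) (sum-∣deviation∣² n) ⟩
    K * (r * r) * (n * (M ^ n * V))  ≡⟨ shuffle₃ K (r * r) n (M ^ n) V ⟩
    K * (r * r) * V * (M ^ n * n)    ≤⟨ ℕ.*-monoˡ-≤ (M ^ n * n) K*r²*V≤n ⟩
    n * (M ^ n * n)                  ≡⟨ shuffle₄ n (M ^ n) ⟩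
    M ^ n * (n * n)                  ∎))
  where
  open Deviation C
  open ℕ.≤-Reasoning
  B = length (List.filter (¬? ∘ typical? C r n) (power C n))
  S = ListAction.sum (List.map (λ x → ∣ deviation n x ∣ * ∣ deviation n x ∣) (power C n))
  V = sumSquares₁
  shuffle₁ : ∀ k m b q → k * m * b * q ≡ k * m * (b * q)
  shuffle₁ = solve-∀
  shuffle₂ : ∀ k m q s → k * m * (q * s) ≡ k * q * (m * s)
  shuffle₂ = solve-∀
  shuffle₃ : ∀ k q n x v → k * q * (n * (x * v)) ≡ k * q * v * (x * n)
  shuffle₃ = solve-∀
  shuffle₄ : ∀ n x → n * (x * n) ≡ x * (n * n)
  shuffle₄ = solve-∀

length-typicalPart : ∀ {d} (C : Code d) r n k → 1 ≤ length C → .{{_ : NonZero n}} →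
  suc k * (r * r) * Deviation.sumSquares₁ C ≤ n →
  k * length (power C n) ≤ suc k * length (typicalPart C r n)
length-typicalPart C r n k 1≤M K*r²*V≤n = ℕ.+-cancelʳ-≤ P _ _ (begin
  k * P + P                ≡⟨ ℕ.+-comm (k * P) P ⟩
  suc k * P                ≡⟨ cong (suc k *_) (length-filter-partition (typical? C r n) (power C n)) ⟨
  suc k * (G + B)          ≡⟨ ℕ.*-distribˡ-+ (suc k) G B ⟩
  suc k * G + suc k * B    ≤⟨ ℕ.+-monoʳ-≤ (suc k * G) (atypical-bound C r n (suc k) 1≤M K*r²*V≤n) ⟩
  suc k * G + length C ^ n ≡⟨ cong (_+_ (suc k * G)) (length-power C n) ⟨
  suc k * G + P            ∎)
  where
  open ℕ.≤-Reasoning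
  P = length (power C n)
  G = length (typicalPart C r n)
  B = length (List.filter (¬? ∘ typical? C r n) (power C n))

deviation-gap : ∀ {d} (C : Code d) n (a b : Word (n * d)) → 2 * totalWt C ≢ d * length C →
  let open Deviation C in
  n ≤ M * ∣ + wt a ℤ.+ + wt b ℤ.- + (n * d) ∣ + ∣ deviation n a ∣ + ∣ deviation n b ∣
deviation-gap {d} C n a b unbalanced = begin
  n                               ≡⟨ ℕ.*-identityʳ n ⟨
  n * 1                           ≤⟨ ℕ.*-monoʳ-≤ n 1≤∣G∣ ⟩
  n * ∣ G ∣                        ≡⟨ ℤ.abs-* (+ n) G ⟨
  ∣ + n ℤ.* G ∣                    ≡⟨ cong ∣_∣ (deviation-identity n a b) ⟩
  ∣ + M ℤ.* Z ℤ.- A ℤ.- B ∣         ≤⟨ ℕ.≤-trans (ℤ.∣i-j∣≤∣i∣+∣j∣ (+ M ℤ.* Z ℤ.- A) B)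
                                              (ℕ.+-monoˡ-≤ ∣ B ∣ (ℤ.∣i-j∣≤∣i∣+∣j∣ (+ M ℤ.* Z) A)) ⟩
  ∣ + M ℤ.* Z ∣ + ∣ A ∣ + ∣ B ∣       ≡⟨ cong (λ z → z + ∣ A ∣ + ∣ B ∣) (ℤ.abs-* (+ M) Z) ⟩
  M * ∣ Z ∣ + ∣ A ∣ + ∣ B ∣           ∎
  where
  open Deviation C
  open ℕ.≤-Reasoning
  Z = + wt a ℤ.+ + wt b ℤ.- + (n * d)
  A = deviation n a
  B = deviation n b
  G = + (2 * τ) ℤ.- + (d * M)
  1≤∣G∣ : 1 ≤ ∣ G ∣
  1≤∣G∣ with ∣ G ∣ in ∣G∣≡
  ... | suc _ = s≤s z≤n
  ... | zero  = ⊥-elim (unbalanced (ℤ.+-injective (ℤ.i-j≡0⇒i≡j _ _ (ℤ.∣i∣≡0⇒i≡0 ∣G∣≡))))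

typical-weight-gap : ∀ {d} (C : Code d) T n {a b : Word (n * d)} → 2 * totalWt C ≢ d * length C →
  let r = 2 + 2 * T * length C in
  Typical C r n a → Typical C r n b → T * (2 * n) < r * ∣ + wt a ℤ.+ + wt b ℤ.- + (n * d) ∣
typical-weight-gap {d} C T n {a} {b} unbalanced a-typical b-typical =
  ℕ.*-cancelˡ-< M _ _ (ℕ.+-cancelʳ-< (n + n) _ _ (begin-strict
    M * (T * (2 * n)) + (n + n)                ≡⟨ expand M T n ⟩
    r * n                                      ≤⟨ ℕ.*-monoʳ-≤ r (deviation-gap C n a b unbalanced) ⟩
    r * (M * ∣ Z ∣ + ∣ A ∣ + ∣ B ∣)               ≡⟨ distribute r M (∣ Z ∣) (∣ A ∣) (∣ B ∣) ⟩
    M * (r * ∣ Z ∣) + (r * ∣ A ∣ + r * ∣ B ∣)     <⟨ ℕ.+-monoʳ-< (M * (r * ∣ Z ∣)) (ℕ.+-mono-< a-typical b-typical) ⟩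
    M * (r * ∣ Z ∣) + (n + n)                   ∎))
  where
  open Deviation C
  open ℕ.≤-Reasoning
  r = 2 + 2 * T * M
  Z = + wt a ℤ.+ + wt b ℤ.- + (n * d)
  A = deviation n a
  B = deviation n b
  expand : ∀ m t n → m * (t * (2 * n)) + (n + n) ≡ (2 + 2 * t * m) * n
  expand = solve-∀
  distribute : ∀ r m z a b → r * (m * z + a + b) ≡ m * (r * z) + (r * a + r * b)
  distribute = solve-∀

typical-spread : ∀ {d} (C : Code d) r n {x y : Word (n * d)} → 1 ≤ length C →
  Typical C r n x → Typical C r n y → r * ∣ + wt x ℤ.- + wt y ∣ ≤ 2 * n
typical-spread C r n {x} {y} 1≤M x-typical y-typical = begin
  r * ∣ + wt x ℤ.- + wt y ∣                ≤⟨ ℕ.*-monoʳ-≤ r (ℕ.m≤n*m _ M {{>-nonZero 1≤M}}) ⟩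
  r * (M * ∣ + wt x ℤ.- + wt y ∣)          ≡⟨ cong (r *_) (trans (sym (ℤ.abs-* (+ M) _)) (cong ∣_∣ identity)) ⟩
  r * ∣ deviation n x ℤ.- deviation n y ∣ ≤⟨ ℕ.*-monoʳ-≤ r (ℤ.∣i-j∣≤∣i∣+∣j∣ (deviation n x) _) ⟩
  r * (∣ deviation n x ∣ + ∣ deviation n y ∣) ≡⟨ ℕ.*-distribˡ-+ r _ _ ⟩
  r * ∣ deviation n x ∣ + r * ∣ deviation n y ∣ ≤⟨ ℕ.+-mono-≤ (ℕ.<⇒≤ x-typical) (ℕ.<⇒≤ y-typical) ⟩
  n + n                                   ≡⟨ cong (_+_ n) (ℕ.+-identityʳ n) ⟨
  2 * n                                   ∎
  where
  open Deviation C
  open ℕ.≤-Reasoning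
  identity : + M ℤ.* (+ wt x ℤ.- + wt y) ≡ deviation n x ℤ.- deviation n y
  identity = trans (cancel (+ M) (+ wt x) (+ wt y) (+ (n * τ)))
                   (sym (cong₂ (λ p q → p ℤ.- + (n * τ) ℤ.- (q ℤ.- + (n * τ))) (ℤ.pos-* M (wt x)) (ℤ.pos-* M (wt y))))
    where
    cancel : ∀ m a b c → m ℤ.* (a ℤ.- b) ≡ m ℤ.* a ℤ.- c ℤ.- (m ℤ.* b ℤ.- c)
    cancel = ℤSolver.solve-∀

prodSize-ratio : ∀ {m m′} T (G : Fin T → Code m) (F : Fin T → Code m′) k K →
  (∀ i → k * length (G i) ≤ K * length (F i)) → k ^ T * prodSize T G ≤ K ^ T * prodSize T F
prodSize-ratio zero    G F k K ratio = ℕ.≤-refl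
prodSize-ratio (suc T) G F k K ratio = begin
  k * k ^ T * (length (G zero) * prodSize T (G ∘ suc))   ≡⟨ ℕ.[m*n]*[o*p]≡[m*o]*[n*p] k (k ^ T) _ _ ⟩
  k * length (G zero) * (k ^ T * prodSize T (G ∘ suc))
    ≤⟨ ℕ.*-mono-≤ (ratio zero) (prodSize-ratio T (G ∘ suc) (F ∘ suc) k K (ratio ∘ suc)) ⟩
  K * length (F zero) * (K ^ T * prodSize T (F ∘ suc))   ≡⟨ ℕ.[m*n]*[o*p]≡[m*o]*[n*p] K (K ^ T) _ _ ⟨
  K * K ^ T * (length (F zero) * prodSize T (F ∘ suc))   ∎
  where open ℕ.≤-Reasoning

prodSize-pos : ∀ {m} T (C : Fin T → Code m) → (∀ i → 1 ≤ length (C i)) → 1 ≤ prodSize T C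
prodSize-pos zero    C nonempty = ℕ.≤-refl
prodSize-pos (suc T) C nonempty = ℕ.*-mono-≤ (nonempty zero) (prodSize-pos T (C ∘ suc) (nonempty ∘ suc))

[1+m+n]^m*n≤[m+n]^[1+m] : ∀ m n → suc (m + n) ^ m * n ≤ (m + n) ^ suc m
[1+m+n]^m*n≤[m+n]^[1+m] zero    n = ℕ.≤-reflexive (trans (ℕ.+-identityʳ n) (sym (ℕ.*-identityʳ n)))
[1+m+n]^m*n≤[m+n]^[1+m] (suc m) n = begin
  suc k * suc k ^ m * n       ≡⟨ rotate (suc k) (suc k ^ m) n ⟩
  suc k ^ m * (suc k * n)     ≤⟨ ℕ.*-monoʳ-≤ (suc k ^ m) [1+k]n≤k[1+n] ⟩
  suc k ^ m * (k * suc n)     ≡⟨ x∙yz≈y∙xz (suc k ^ m) k (suc n) ⟩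
  k * (suc k ^ m * suc n)     ≤⟨ ℕ.*-monoʳ-≤ k induction ⟩
  k * k ^ suc m               ∎
  where
  open ℕ.≤-Reasoning
  k = suc (m + n)
  induction : suc k ^ m * suc n ≤ k ^ suc m
  induction = subst (λ z → suc z ^ m * suc n ≤ z ^ suc m) (ℕ.+-suc m n) ([1+m+n]^m*n≤[m+n]^[1+m] m (suc n))
  [1+k]n≤k[1+n] : suc k * n ≤ k * suc n
  [1+k]n≤k[1+n] = ℕ.≤-trans (ℕ.+-monoˡ-≤ (k * n) (ℕ.≤-trans (ℕ.m≤n+m n m) (ℕ.n≤1+n (m + n))))
                            (ℕ.≤-reflexive (sym (ℕ.*-suc k n)))
  rotate : ∀ a b c → a * b * c ≡ b * (a * c)
  rotate = solve-∀

[2+2m]^m<2*[1+2m]^m : ∀ m → suc (m + suc m) ^ m < 2 * (m + suc m) ^ m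
[2+2m]^m<2*[1+2m]^m m = ℕ.*-cancelʳ-< (suc m) _ _ (ℕ.≤-<-trans ([1+m+n]^m*n≤[m+n]^[1+m] m (suc m)) (begin-strict
  k * k ^ m                ≡⟨ ℕ.*-comm k (k ^ m) ⟩
  k ^ m * k                <⟨ ℕ.*-monoʳ-< (k ^ m) {{>-nonZero k^m>0}} (ℕ.n<1+n k) ⟩
  k ^ m * suc k            ≡⟨ double (k ^ m) m ⟩
  2 * k ^ m * suc m        ∎))
  where
  open ℕ.≤-Reasoning
  k = m + suc m
  k^m>0 : 0 < k ^ m
  k^m>0 = ℕ.m^n>0 k {{≢-nonZero (ℕ.m+1+n≢0 m)}} m
  double : ∀ x m → x * suc (m + suc m) ≡ 2 * x * suc m
  double = solve-∀

[1+2m]^m*a≤[2+2m]^m*x⇒a<2x : ∀ m {a x} → 1 ≤ a → (m + suc m) ^ m * a ≤ suc (m + suc m) ^ m * x → a < 2 * x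
[1+2m]^m*a≤[2+2m]^m*x⇒a<2x m {a} {x} 1≤a ratio = ℕ.*-cancelʳ-< (K ^ m) a (2 * x) (begin-strict
  a * K ^ m            <⟨ ℕ.*-monoʳ-< a {{>-nonZero 1≤a}} ([2+2m]^m<2*[1+2m]^m m) ⟩
  a * (2 * k ^ m)      ≡⟨ x∙yz≈y∙xz a 2 (k ^ m) ⟩
  2 * (a * k ^ m)      ≡⟨ cong (2 *_) (ℕ.*-comm a (k ^ m)) ⟩
  2 * (k ^ m * a)      ≤⟨ ℕ.*-monoʳ-≤ 2 ratio ⟩
  2 * (K ^ m * x)      ≡⟨ cong (2 *_) (ℕ.*-comm (K ^ m) x) ⟩
  2 * (x * K ^ m)      ≡⟨ ℕ.*-assoc 2 x (K ^ m) ⟨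
  2 * x * K ^ m        ∎)
  where
  open ℕ.≤-Reasoning
  k = m + suc m
  K = suc k

distance-shift : ∀ p q s N → p + N ≡ q + s → + p ℤ.- + q ≡ + s ℤ.- + N
distance-shift p q s N eq = begin
  + p ℤ.- + q                          ≡⟨ shift (+ p) (+ q) (+ N) ⟩
  (+ p ℤ.+ + N) ℤ.- (+ q ℤ.+ + N)      ≡⟨ cong₂ ℤ._-_ (trans (sym (ℤ.pos-+ p N)) (trans (cong +_ eq) (ℤ.pos-+ q s)))
                                                     (ℤ.+-comm (+ q) (+ N)) ⟩
  (+ q ℤ.+ + s) ℤ.- (+ N ℤ.+ + q)      ≡⟨ unshift (+ q) (+ s) (+ N) ⟩
  + s ℤ.- + N                          ∎
  where
  open ≡-Reasoning
  shift : ∀ p q n → p ℤ.- q ≡ (p ℤ.+ n) ℤ.- (q ℤ.+ n)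
  shift = ℤSolver.solve-∀
  unshift : ∀ q s n → (q ℤ.+ s) ℤ.- (n ℤ.+ q) ≡ s ℤ.- n
  unshift = ℤSolver.solve-∀

-- The improved code

precision : ∀ {d T} → (Fin T → Code d) → Fin T → ℕ
precision {T = T} C j = 2 + 2 * T * length (C j)

module _ {d T : ℕ} (C : Fin T → Code d) (j : Fin T) (n : ℕ) where

  private
    r : ℕ
    r = precision C j

  typicalParts : Fin T → Code (n * d)
  typicalParts i = typicalPart (C i) r n

  typical : ∀ {i x} → x ∈ typicalParts i → Typical (C i) r n x
  typical {i} x∈ = proj₂ (∈-filter⁻ (typical? (C i) r n) {xs = power (C i) n} x∈)

  Unique-typicalParts : (∀ i → Unique (C i)) → ∀ i → Unique (typicalParts i)
  Unique-typicalParts unique i = Unique.filter⁺ (typical? (C i) r n) (Unique-power (unique i) n)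

  UD-typicalParts : UD T C → UD T typicalParts
  UD-typicalParts ud u v u∈ v∈ = UD-power T ud n u v (in-power ∘ u∈) (in-power ∘ v∈)
    where
    in-power : ∀ {i x} → x ∈ typicalParts i → x ∈ power (C i) n
    in-power {i} x∈ = proj₁ (∈-filter⁻ (typical? (C i) r n) {xs = power (C i) n} x∈)

  typicalParts-self-disjoint : 2 * totalWt (C j) ≢ d * length (C j) →
    ∀ {a b} → a ∈ typicalParts j → b ∈ typicalParts j → a ≢ complement b
  typicalParts-self-disjoint unbalanced {a} {b} a∈ b∈ a≡b̅ =
    ℕ.<⇒≱ (typical-weight-gap (C j) T n {a} {b} unbalanced (typical a∈) (typical b∈)) (ℕ.≤-trans r*0≤ z≤n)
    where
    balanced : + wt a ℤ.+ + wt b ℤ.- + (n * d) ≡ + 0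
    balanced = begin
      + wt a ℤ.+ + wt b ℤ.- + (n * d)   ≡⟨ cong (ℤ._- + (n * d)) (ℤ.pos-+ (wt a) (wt b)) ⟨
      + (wt a + wt b) ℤ.- + (n * d)     ≡⟨ cong (λ z → + (wt z + wt b) ℤ.- + (n * d)) a≡b̅ ⟩
      + (wt (complement b) + wt b) ℤ.- + (n * d) ≡⟨ cong (λ z → + z ℤ.- + (n * d)) (wt-complement b) ⟩
      + (n * d) ℤ.- + (n * d)           ≡⟨ ℤ.+-inverseʳ (+ (n * d)) ⟩
      + 0                               ∎
      where open ≡-Reasoning
    r*0≤ : r * ∣ + wt a ℤ.+ + wt b ℤ.- + (n * d) ∣ ≤ 0
    r*0≤ = ℕ.≤-reflexive (trans (cong (λ z → r * ∣ z ∣) balanced) (ℕ.*-zeroʳ r))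

  -- If u j = a and v j = complement b, then swapping v j for a turns v into a tuple w of typical
  -- words whose total weight exceeds that of u by wt a + wt b − n d; the spread of typical
  -- weights bounds this by 2Tn/r, contradicting the weight gap of user j.
  typicalParts-sums-disjoint : (∀ i → 1 ≤ length (C i)) → 2 * totalWt (C j) ≢ d * length (C j) →
    ∀ u v → (∀ i → u i ∈ typicalParts i) → (∀ i → v i ∈ complementAt typicalParts j i) →
    sumWords T u ≢ sumWords T v
  typicalParts-sums-disjoint nonempty unbalanced u v u∈ v∈ sums
    with v-others , vj∈ ← ∈-updateAt⁻ v∈
    with b , b∈ , vj≡b̅ ← ∈-map⁻ complement vj∈ =
    ℕ.<⇒≱ (typical-weight-gap (C j) T n {u j} {b} unbalanced (typical (u∈ j)) (typical b∈)) spread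
    where
    w = Tuple.updateAt v j (const (u j))
    w∈ : ∀ i → w i ∈ typicalParts i
    w∈ = updateAt-∈ v-others (u∈ j)

    total : sum (wt ∘ u) ≡ sum (wt ∘ v)
    total = trans (sym (Vec-sum-sumWords T u)) (trans (cong Vec.sum sums) (Vec-sum-sumWords T v))

    exchange : sum (wt ∘ w) + n * d ≡ sum (wt ∘ u) + (wt (u j) + wt b)
    exchange = begin
      sum (wt ∘ w) + n * d
        ≡⟨ cong₂ _+_ (sum-cong-≗ (Tupleₚ.map-updateAt-local {f = wt} {g = const (u j)} v j refl))
                     (trans (sym (wt-complement b)) (cong (λ z → wt z + wt b) (sym vj≡b̅))) ⟩
      sum (Tuple.updateAt (wt ∘ v) j (const (wt (u j)))) + (wt (v j) + wt b)
        ≡⟨ ℕ.+-assoc _ (wt (v j)) (wt b) ⟨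
      sum (Tuple.updateAt (wt ∘ v) j (const (wt (u j)))) + wt (v j) + wt b
        ≡⟨ cong (_+ wt b) (sum-updateAt (wt ∘ v) j (wt (u j))) ⟩
      sum (wt ∘ v) + wt (u j) + wt b
        ≡⟨ trans (ℕ.+-assoc _ (wt (u j)) (wt b)) (cong (_+ (wt (u j) + wt b)) (sym total)) ⟩
      sum (wt ∘ u) + (wt (u j) + wt b) ∎
      where open ≡-Reasoning

    spread : r * ∣ + wt (u j) ℤ.+ + wt b ℤ.- + (n * d) ∣ ≤ T * (2 * n)
    spread = begin
      r * ∣ + wt (u j) ℤ.+ + wt b ℤ.- + (n * d) ∣
        ≡⟨ cong (λ z → r * ∣ z ℤ.- + (n * d) ∣) (ℤ.pos-+ (wt (u j)) (wt b)) ⟨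
      r * ∣ + (wt (u j) + wt b) ℤ.- + (n * d) ∣
        ≡⟨ cong (λ z → r * ∣ z ∣) (distance-shift (sum (wt ∘ w)) (sum (wt ∘ u)) (wt (u j) + wt b) (n * d) exchange) ⟨
      r * ∣ + sum (wt ∘ w) ℤ.- + sum (wt ∘ u) ∣
        ≤⟨ *-∣sum-sum∣-≤ (wt ∘ w) (wt ∘ u) r (2 * n)
             (λ i → typical-spread (C i) r n {w i} {u i} (nonempty i) (typical (w∈ i)) (typical (u∈ i))) ⟩
      T * (2 * n) ∎
      where open ℕ.≤-Reasoning

  prodSize-power<prodSize-augmentAt : (∀ i → 1 ≤ length (C i)) → .{{_ : NonZero n}} →
    (∀ i → suc (T + suc T) * (r * r) * Deviation.sumSquares₁ (C i) ≤ n) →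
    prodSize T C ^ n < prodSize T (augmentAt typicalParts j)
  prodSize-power<prodSize-augmentAt nonempty n-large =
    subst₂ _<_ (prodSize-power T C n) (sym (prodSize-augmentAt T typicalParts j))
      ([1+2m]^m*a≤[2+2m]^m*x⇒a<2x T (prodSize-pos T (λ i → power (C i) n) 1≤length-power)
        (prodSize-ratio T (λ i → power (C i) n) typicalParts (T + suc T) _
          λ i → length-typicalPart (C i) r n (T + suc T) (nonempty i) (n-large i)))
    where
    1≤length-power : ∀ i → 1 ≤ length (power (C i) n)
    1≤length-power i = subst (1 ≤_) (sym (length-power (C i) n)) (ℕ.m^n>0 (length (C i)) {{>-nonZero (nonempty i)}} n)

theorem1 : (T d : ℕ) → 1 ≤ T → 1 ≤ d →
    (C : Fin T → Code d) →
    (∀ i → Unique (C i)) →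
    (∀ i → C i ≢ []) →
    UD T C →
    (∃ λ j → 2 * totalWt (C j) ≢ d * length (C j)) →
    Σ ℕ λ n → 1 ≤ n ×
      Σ (Fin T → Code (d * n)) λ Cs →
        (∀ i → Unique (Cs i)) × UD T Cs × (prodSize T C ^ n < prodSize T Cs)
theorem1 T d _ _ C unique nonempty ud (j , unbalanced) = n , s≤s z≤n , subst Improves (ℕ.*-comm n d)
  ( augmentAt (typicalParts C j n) j
  , Unique-augmentAt j (Unique-typicalParts C j n unique) (typicalParts-self-disjoint C j n unbalanced)
  , augmentAt-UD T j (UD-typicalParts C j n ud) (typicalParts-sums-disjoint C j n 1≤length unbalanced)
  , prodSize-power<prodSize-augmentAt C j n 1≤length
      λ i → ℕ.≤-trans (ℕ.*-monoʳ-≤ (K * (r * r)) (≤-sum V i)) (ℕ.n≤1+n _))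
  where
  r = precision C j
  K = suc (T + suc T)
  V = λ i → Deviation.sumSquares₁ (C i)
  n = suc (K * (r * r) * sum V)
  Improves : ℕ → Set
  Improves m = Σ (Fin T → Code m) λ Cs → (∀ i → Unique (Cs i)) × UD T Cs × (prodSize T C ^ n < prodSize T Cs)
  1≤length : ∀ i → 1 ≤ length (C i)
  1≤length i with C i | nonempty i
  ... | []    | C≢[] = ⊥-elim (C≢[] refl)
  ... | _ ∷ _ | _    = s≤s z≤n
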